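{- Let $\mathcal{A}$ be a strongly connected $d$-dimensional VASS with at least one transition, and assume that on input $\mathcal{A}$ Algorithm 1 (described in the context) returns a tuple $(k,\mathit{tight})\in\mathbb{N}\times\{\mathit{true},\mathit{false}\}$. Then $k\in\{1,\dots,d\}$ and $\mathcal{A}$ is terminating. Moreover, if $\mathit{tight}=\mathit{true}$, then $\mathcal{L}(n)\in\mathcal{O}(n^k)$.
   Context: A $d$-dimensional VASS is a pair $\mathcal{A}=(Q,T)$ with $Q$ a finite nonempty set of states and $T\subseteq Q\times\mathbb{Z}^d\times Q$ a finite set of transitions such that every state has an outgoing transition. A configuration is $p\mathbf{v}$ with $p\in Q$, $\mathbf{v}\in\mathbb{N}^d$, of size $\max_i\mathbf{v}(i)$. A computation from $p_0\mathbf{v}_0$ is a sequence of configurations $p_0\mathbf{v}_0,\dots,p_n\mathbf{v}_n$ (vectors in $\mathbb{N}^d$) with transitions $(p_i,\mathbf{u}_{i+1},p_{i+1})\in T$ and $\mathbf{v}_{i+1}=\mathbf{v}_i+\mathbf{u}_{i+1}$; length $n$. $L(p\mathbf{v})\in\mathbb{N}\cup\{\infty\}$ is the least bound on lengths of computations from $p\mathbf{v}$; $\mathcal{L}(n)=\sup\{L(p\mathbf{v}):\text{size}(p\mathbf{v})=n\}$; $\mathcal{A}$ is terminating if $\mathcal{L}(n)<\infty$ for all $n$. $g\in\mathcal{O}(h)$ means $g(n)\le a\,h(n)$ for some constant $a>0$ and all sufficiently large $n$. A sub-VASS is a VASS $(Q',T')$ with $Q'\subseteq Q$, $T'\subseteq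 T$; strongly connected means a nonempty path between any two states; an SCC of a graph $(Q,T')$ is a maximal strongly connected sub-VASS of it. A linear map is $f(p\mathbf{v})=\mathbf{c}_f^\top\mathbf{v}+\mathbf{w}_f(p)$ with $\mathbf{c}_f\in\mathbb{Q}^d$, $\mathbf{w}_f\in\mathbb{Q}^Q$; a transition $(p,\mathbf{u},q)$ is $f$-ranked if $\mathbf{c}_f^\top\mathbf{u}+\mathbf{w}_f(q)\le\mathbf{w}_f(p)-1$ and $f$-neutral if $\mathbf{c}_f^\top\mathbf{u}+\mathbf{w}_f(q)=\mathbf{w}_f(p)$. A QRF is a linear map with $\mathbf{c}_f\ge\vec0$ such that every transition is $f$-ranked or $f$-neutral; positive if $\mathbf{c}_f>\vec0$. Algorithm 1: set $\mathit{tight}:=\mathit{true}$ iff a positive QRF for $\mathcal{A}$ exists; $k:=\mathrm{Decompose}(\mathcal{A})$; if $k=\infty$ return "non-terminating", else return $(k,\mathit{tight})$. $\mathrm{Decompose}(\mathcal{A})$: pick a QRF $f$ maximizing the number of $f$-ranked transitions; $T_f:=$ set of $f$-neutral transitions; if $T_f$ contains all transitions return $\infty$; if $T_f=\emptyset$ return $1$; otherwise with $\mathcal{A}_1,\dots,\mathcal{A}_\ell$ all SCCs of $(Q,T_f)$ return $1+\max_i\mathrm{Decompose}(\mathcal{A}_i)$. -}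

module Defs where

open import Data.Nat as ℕ using (ℕ; zero; suc; _⊔_; _^_)
open import Data.Integer as ℤ using (ℤ)
open import Data.Rational as ℚ using (ℚ; 0ℚ; 1ℚ)
open import Data.Rational.Properties as ℚP using ()
open import Data.Fin using (Fin; zero; suc)
open import Data.List using (List; []; _∷_; filter; length)
open import Data.List.Membership.Propositional using (_∈_)
open import Data.List.Relation.Unary.All using (All)
open import Data.List.Relation.Unary.Any using (Any)
open import Data.List.Relation.Unary.Unique.Propositional using (Unique)
open import Data.Product using (Σ; _×_; ∃)
open import Data.Sum using (_⊎_)
open import Data.Bool using (Bool; true)
open import Relation.Binary.PropositionalEquality using (_≡_; _≢_)
open import Relation.Nullary using (¬_)
open import Relation.Nullary.Decidable using (Dec)

-- VASS.  States are drawn from an ambient finite type Fin m, so that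
-- sub-VASS (needed by Decompose) live over the same state type.
-- Finite sets are represented by duplicate-free lists.

record Trans (m d : ℕ) : Set where
  constructor tr
  field
    src : Fin m
    upd : Fin d → ℤ
    tgt : Fin m
open Trans public

record VASS (m d : ℕ) : Set where
  constructor vass
  field
    states : List (Fin m)
    trans  : List (Trans m d)
open VASS public

record IsVASS {m d : ℕ} (A : VASS m d) : Set where
  field
    nonempty   : states A ≢ []
    uniqQ      : Unique (states A)
    uniqT      : Unique (trans A)
    endpoints  : All (λ t → (src t ∈ states A) × (tgt t ∈ states A)) (trans A)
    outgoing   : All (λ p → Any (λ t → src t ≡ p) (trans A)) (states A)

data Path {m d : ℕ} (Ts : List (Trans m d)) : Fin m → Fin m → Set where
  one  : ∀ {t} → t ∈ Ts → Path Ts (src t) (tgt t)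
  cons : ∀ {t q} → t ∈ Ts → Path Ts (tgt t) q → Path Ts (src t) q

StronglyConnected : {m d : ℕ} → VASS m d → Set
StronglyConnected A = ∀ p q → p ∈ states A → q ∈ states A → Path (trans A) p q

record SubVASS {m d : ℕ} (Qs : List (Fin m)) (Ts : List (Trans m d))
                (B : VASS m d) : Set where
  field
    statesSub : ∀ {p} → p ∈ states B → p ∈ Qs
    transSub  : ∀ {t} → t ∈ trans B → t ∈ Ts
    inside    : All (λ t → (src t ∈ states B) × (tgt t ∈ states B)) (trans B)

_⊑_ : {m d : ℕ} → VASS m d → VASS m d → Set
B ⊑ B' = (∀ {p} → p ∈ states B → p ∈ states B')
       × (∀ {t} → t ∈ trans B → t ∈ trans B')

record IsSCC {m d : ℕ} (Qs : List (Fin m)) (Ts : List (Trans m d))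
             (B : VASS m d) : Set where
  field
    isVASS  : IsVASS B
    sub     : SubVASS Qs Ts B
    sc      : StronglyConnected B
    maximal : ∀ B' → SubVASS Qs Ts B' → StronglyConnected B' → B ⊑ B' → B' ⊑ B

data Comp {m d : ℕ} (A : VASS m d) : Fin m → (Fin d → ℕ) → ℕ → Set where
  stop : ∀ {p v} → Comp A p v 0
  step : ∀ {v n} (t : Trans m d) → t ∈ trans A →
         (w : Fin d → ℕ) → (∀ i → ℤ.+ (w i) ≡ ℤ.+ (v i) ℤ.+ upd t i) →
         Comp A (tgt t) w n → Comp A (src t) v (suc n)

size : {d : ℕ} → (Fin d → ℕ) → ℕ
size {zero}  v = 0
size {suc d} v = v zero ⊔ size (λ i → v (suc i))

-- 𝓛(n) ≤ b : every computation from every configuration of size n has length ≤ b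
LBoundedBy : {m d : ℕ} → VASS m d → ℕ → ℕ → Set
LBoundedBy {m} {d} A n b =
  ∀ (p : Fin m) (v : Fin d → ℕ) (len : ℕ) →
  p ∈ states A → size v ≡ n → Comp A p v len → len ℕ.≤ b

Terminating : {m d : ℕ} → VASS m d → Set
Terminating A = ∀ n → ∃ λ b → LBoundedBy A n b

LinO : {m d : ℕ} → VASS m d → ℕ → Set
LinO A k = Σ ℕ λ a → (0 ℕ.< a) × Σ ℕ λ N → ∀ n → N ℕ.≤ n → LBoundedBy A n (a ℕ.* n ^ k)

record LinMap (m d : ℕ) : Set where
  constructor linmap
  field
    c : Fin d → ℚ
    w : Fin m → ℚ
open LinMap public

toℚ : ℤ → ℚ
toℚ z = z ℚ./ 1

dot : {d : ℕ} → (Fin d → ℚ) → (Fin d → ℤ) → ℚ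
dot {zero}  c u = 0ℚ
dot {suc d} c u = c zero ℚ.* toℚ (u zero) ℚ.+ dot (λ i → c (suc i)) (λ i → u (suc i))

lhs : {m d : ℕ} → LinMap m d → Trans m d → ℚ
lhs f t = dot (c f) (upd t) ℚ.+ w f (tgt t)

Ranked : {m d : ℕ} → LinMap m d → Trans m d → Set
Ranked f t = lhs f t ℚ.≤ w f (src t) ℚ.- 1ℚ

Neutral : {m d : ℕ} → LinMap m d → Trans m d → Set
Neutral f t = lhs f t ≡ w f (src t)

ranked? : {m d : ℕ} (f : LinMap m d) (t : Trans m d) → Dec (Ranked f t)
ranked? f t = lhs f t ℚP.≤? (w f (src t) ℚ.- 1ℚ)

neutral? : {m d : ℕ} (f : LinMap m d) (t : Trans m d) → Dec (Neutral f t)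
neutral? f t = lhs f t ℚP.≟ w f (src t)

IsQRF : {m d : ℕ} → VASS m d → LinMap m d → Set
IsQRF A f = (∀ i → 0ℚ ℚ.≤ c f i) × All (λ t → Ranked f t ⊎ Neutral f t) (trans A)

IsPositiveQRF : {m d : ℕ} → VASS m d → LinMap m d → Set
IsPositiveQRF A f = IsQRF A f × (∀ i → 0ℚ ℚ.< c f i)

#ranked : {m d : ℕ} → VASS m d → LinMap m d → ℕ
#ranked A f = length (filter (ranked? f) (trans A))

IsMaxQRF : {m d : ℕ} → VASS m d → LinMap m d → Set
IsMaxQRF A f = IsQRF A f × (∀ g → IsQRF A g → #ranked A g ℕ.≤ #ranked A f)

neutralTrans : {m d : ℕ} → VASS m d → LinMap m d → List (Trans m d)
neutralTrans A f = filter (neutral? f) (trans A)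

-- Procedure Decompose, as a (possibly nondeterministic) relation
-- Decompose A r : "some run of Decompose(A) returns r"

data Res : Set where
  fin : ℕ → Res
  ∞   : Res

data _≤R_ : Res → Res → Set where
  fin≤fin : ∀ {a b} → a ℕ.≤ b → fin a ≤R fin b
  _≤∞     : ∀ r → r ≤R ∞

1+R : Res → Res
1+R (fin n) = fin (suc n)
1+R ∞       = ∞

data Decompose {m d : ℕ} (A : VASS m d) : Res → Set where
  dec-∞   : (f : LinMap m d) → IsMaxQRF A f →
            All (Neutral f) (trans A) → Decompose A ∞
  dec-1   : (f : LinMap m d) → IsMaxQRF A f →
            All (λ t → ¬ Neutral f t) (trans A) → Decompose A (fin 1)
  -- otherwise: 1 + max over all SCCs A_i of (Q, T_f) of Decompose(A_i)
  dec-rec : (f : LinMap m d) → IsMaxQRF A f →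
            Any (Neutral f) (trans A) → ¬ All (Neutral f) (trans A) →
            (res : (B : VASS m d) → IsSCC (states A) (neutralTrans A f) B → Res) →
            (∀ B s → Decompose B (res B s)) →
            (r : Res) →
            (∀ B s → res B s ≤R r) →
            ((Σ (VASS m d) λ B → Σ (IsSCC (states A) (neutralTrans A f) B) λ s → res B s ≡ r)
              ⊎ ((r ≡ fin 0) × (∀ B → ¬ IsSCC (states A) (neutralTrans A f) B))) →
            Decompose A (1+R r)

record Alg1Returns {m d : ℕ} (A : VASS m d) (k : ℕ) (tight : Bool) : Set where
  field
    tightSpec : (tight ≡ true → Σ (LinMap m d) (IsPositiveQRF A))
              × (Σ (LinMap m d) (IsPositiveQRF A) → tight ≡ true)
    decomp    : Decompose A (fin k)

-- Each round of Decompose picks a quasi-ranking function f. Its potential c·v + w(p) never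
-- increases and drops by at least 1 on ranked transitions, so a computation from size s makes
-- O(s) ranked steps. In between it only uses f-neutral transitions and hence visits the SCCs of
-- those in topological order, staying in each for at most the bound obtained recursively for that
-- SCC. This gives termination, and a bound O(s^k) when all configurations keep size O(s), which a
-- positive QRF guarantees. Finally, every round yields a cycle effect e with f(e) ≠ 0 while all
-- effects of later rounds are f-neutral cycles; these effects are linearly independent, so k ≤ d.
module Submission where

open import Defs
open import Data.Bool using (Bool; true)
open import Data.Empty using (⊥-elim)
open import Data.Fin as Fin using (Fin; zero; suc; punchIn)
open import Data.Integer as ℤ using (ℤ)
open import Data.Integer.Properties as ℤP using ()
open import Data.List using (List; []; _∷_; filter; length; map; tabulate; allFin)
import Data.List.Extrema
open import Data.List.Membership.Propositional using (_∈_; lose; find)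
import Data.List.Membership.DecPropositional as DecMembership
open import Data.List.Membership.Propositional.Properties
  using (∈-map⁺; ∈-tabulate⁺; ∈-filter⁺; ∈-filter⁻; ∈-allFin)
open import Data.List.Properties as ListP using ()
open import Data.List.Relation.Binary.Subset.Propositional using (_⊆_)
open import Data.List.Relation.Unary.All as All using (All; []; _∷_)
open import Data.List.Relation.Unary.All.Properties.Core using (¬All⇒Any¬)
open import Data.List.Relation.Unary.Any as Any using (Any; any?)
open import Data.List.Relation.Unary.Unique.Propositional using (Unique)
import Data.List.Relation.Unary.Unique.Propositional.Properties as Unique
open import Data.Nat as ℕ using (ℕ; zero; suc; z≤n; s≤s; _⊔_; _^_)
open import Data.Nat.Coprimality as Coprime using ()
open import Data.Nat.Properties as ℕP using ()
open import Data.Nat.Solver using () renaming (module +-*-Solver to ℕ-Solver)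
open import Data.Product using (Σ; _×_; _,_; proj₁; proj₂)
open import Data.Rational as ℚ using (ℚ; 0ℚ; 1ℚ; mkℚ; _+_; _*_; _-_)
open import Data.Rational.Properties as ℚP using ()
open import Data.Rational.Solver using () renaming (module +-*-Solver to ℚ-Solver)
open import Data.Sum using (_⊎_; inj₁; inj₂)
open import Data.Unit using (⊤)
open import Relation.Binary.Bundles using (DecTotalOrder)
open import Relation.Binary.PropositionalEquality as ≡
  using (_≡_; _≢_; refl; sym; cong; cong₂; subst; subst₂; module ≡-Reasoning)
open import Relation.Nullary using (¬_; Dec; yes; no; ¬?)
open import Relation.Nullary.Decidable using (_×-dec_; _⊎-dec_)
open import Algebra.Properties.Group ℚP.+-0-group using (identityˡ-unique)

module ℕExtrema = Data.List.Extrema ℕP.≤-totalOrder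
module ℚExtrema = Data.List.Extrema (DecTotalOrder.totalOrder ℚP.≤-decTotalOrder)

bounded-above : ∀ {a} {A : Set a} (h : A → ℕ) (xs : List A) →
  Σ ℕ λ n → ∀ {x} → x ∈ xs → h x ℕ.≤ n
bounded-above h xs = ℕExtrema.max 0 (map h xs) ,
  λ x∈xs → All.lookup (ℕExtrema.xs≤max 0 (map h xs)) (∈-map⁺ h x∈xs)

length-allFin : ∀ n → length (allFin n) ℕ.≤ n
length-allFin n = ℕP.≤-reflexive (ListP.length-tabulate (λ i → i))

∈⇒≢[] : ∀ {a} {A : Set a} {x : A} {xs} → x ∈ xs → xs ≢ []
∈⇒≢[] {xs = []}    ()
∈⇒≢[] {xs = _ ∷ _} _  ()

ℚ-bounded-below : ∀ {n} (h : Fin n → ℚ) → Σ ℚ λ q → ∀ i → q ℚ.≤ h i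
ℚ-bounded-below h = ℚExtrema.min 0ℚ (tabulate h) ,
  λ i → All.lookup (ℚExtrema.min≤xs 0ℚ (tabulate h)) (∈-tabulate⁺ i)

ℚ-bounded-above : ∀ {n} (h : Fin n → ℚ) → Σ ℚ λ q → ∀ i → h i ℚ.≤ q
ℚ-bounded-above h = ℚExtrema.max 0ℚ (tabulate h) ,
  λ i → All.lookup (ℚExtrema.xs≤max 0ℚ (tabulate h)) (∈-tabulate⁺ i)

-- toℚ z = z / 1 is computed by normalisation; integral z is its normal form, on which ℚ's
-- addition and multiplication compute to the normal form of the integer result.
private
  integral : ℤ → ℚ
  integral z = mkℚ z 0 (Coprime.sym (Coprime.1-coprimeTo ℤ.∣ z ∣))

  toℚ≡integral : ∀ z → toℚ z ≡ integral z
  toℚ≡integral z = ℚP.↥p/↧p≡p (integral z)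

toℚ-homo-+ : ∀ a b → toℚ (a ℤ.+ b) ≡ toℚ a + toℚ b
toℚ-homo-+ a b = begin
  toℚ (a ℤ.+ b)
    ≡⟨ cong₂ (λ x y → toℚ (x ℤ.+ y)) (sym (ℤP.*-identityʳ a)) (sym (ℤP.*-identityʳ b)) ⟩
  integral a + integral b
    ≡⟨ cong₂ _+_ (sym (toℚ≡integral a)) (sym (toℚ≡integral b)) ⟩
  toℚ a + toℚ b ∎
  where open ≡-Reasoning

toℚ-homo-* : ∀ a b → toℚ (a ℤ.* b) ≡ toℚ a * toℚ b
toℚ-homo-* a b = cong₂ _*_ (sym (toℚ≡integral a)) (sym (toℚ≡integral b))

toℚ-mono-≤ : ∀ {a b} → a ℤ.≤ b → toℚ a ℚ.≤ toℚ b
toℚ-mono-≤ {a} {b} a≤b = subst₂ ℚ._≤_ (sym (toℚ≡integral a)) (sym (toℚ≡integral b))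
  (ℚ.*≤* (subst₂ ℤ._≤_ (sym (ℤP.*-identityʳ a)) (sym (ℤP.*-identityʳ b)) a≤b))

toℚ-cancel-≤ : ∀ {a b} → toℚ a ℚ.≤ toℚ b → a ℤ.≤ b
toℚ-cancel-≤ {a} {b} le with subst₂ ℚ._≤_ (toℚ≡integral a) (toℚ≡integral b) le
... | ℚ.*≤* a*1≤b*1 = subst₂ ℤ._≤_ (ℤP.*-identityʳ a) (ℤP.*-identityʳ b) a*1≤b*1

fromℕ : ℕ → ℚ
fromℕ n = toℚ (ℤ.+ n)

fromℕ-homo-+ : ∀ a b → fromℕ (a ℕ.+ b) ≡ fromℕ a + fromℕ b
fromℕ-homo-+ a b = toℚ-homo-+ (ℤ.+ a) (ℤ.+ b)

fromℕ-homo-* : ∀ a b → fromℕ (a ℕ.* b) ≡ fromℕ a * fromℕ b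
fromℕ-homo-* a b = ≡.trans (cong toℚ (ℤP.pos-* a b)) (toℚ-homo-* (ℤ.+ a) (ℤ.+ b))

fromℕ-suc : ∀ a → fromℕ (suc a) ≡ fromℕ a + 1ℚ
fromℕ-suc a = ≡.trans (cong fromℕ (ℕP.+-comm 1 a)) (fromℕ-homo-+ a 1)

fromℕ-mono-≤ : ∀ {a b} → a ℕ.≤ b → fromℕ a ℚ.≤ fromℕ b
fromℕ-mono-≤ a≤b = toℚ-mono-≤ (ℤ.+≤+ a≤b)

fromℕ-nonNeg : ∀ n → 0ℚ ℚ.≤ fromℕ n
fromℕ-nonNeg n = fromℕ-mono-≤ (z≤n {n})

fromℕ-cancel-≤ : ∀ {a b} → fromℕ a ℚ.≤ fromℕ b → a ℕ.≤ b
fromℕ-cancel-≤ {a} {b} le with toℚ-cancel-≤ {ℤ.+ a} {ℤ.+ b} le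
... | ℤ.+≤+ a≤b = a≤b

archimedean : ∀ q → Σ ℕ λ n → q ℚ.≤ fromℕ n
archimedean q@(mkℚ (ℤ.+ n) _ _) =
  n , subst (q ℚ.≤_) (sym (toℚ≡integral (ℤ.+ n)))
        (ℚ.*≤* (ℤP.*-monoˡ-≤-nonNeg (ℤ.+ n) (ℤ.+≤+ (s≤s z≤n))))
archimedean (mkℚ ℤ.-[1+ _ ] _ _) = 0 , ℚ.*≤* ℤ.-≤+

p-1<p : ∀ p → p - 1ℚ ℚ.< p
p-1<p p = subst (p - 1ℚ ℚ.<_) (ℚP.+-identityʳ p) (ℚP.+-monoʳ-< p (ℚ.*<* ℤ.-<+))

p<p+1 : ∀ p → p ℚ.< p + 1ℚ
p<p+1 p = subst (ℚ._< p + 1ℚ) (ℚP.+-identityʳ p) (ℚP.+-monoʳ-< p (ℚ.*<* (ℤ.+<+ (s≤s z≤n))))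

toℤᵛ : ∀ {d} → (Fin d → ℕ) → Fin d → ℤ
toℤᵛ v i = ℤ.+ v i

coeffSum : ∀ {d} → (Fin d → ℚ) → ℚ
coeffSum {zero}  c = 0ℚ
coeffSum {suc d} c = c zero + coeffSum (λ i → c (suc i))

dot-cong : ∀ {d} (c : Fin d → ℚ) {a b : Fin d → ℤ} → (∀ i → a i ≡ b i) → dot c a ≡ dot c b
dot-cong {zero}  c a≡b = refl
dot-cong {suc d} c a≡b =
  cong₂ _+_ (cong (λ x → c zero * toℚ x) (a≡b zero)) (dot-cong (λ i → c (suc i)) (λ i → a≡b (suc i)))

dot-homo-+ : ∀ {d} (c : Fin d → ℚ) (a b : Fin d → ℤ) →
  dot c (λ i → a i ℤ.+ b i) ≡ dot c a + dot c b
dot-homo-+ {zero}  c a b = refl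
dot-homo-+ {suc d} c a b = begin
  c zero * toℚ (a zero ℤ.+ b zero) + dot c′ (λ i → a (suc i) ℤ.+ b (suc i))
    ≡⟨ cong₂ (λ x y → c zero * x + y) (toℚ-homo-+ (a zero) (b zero))
             (dot-homo-+ c′ (λ i → a (suc i)) (λ i → b (suc i))) ⟩
  c zero * (toℚ (a zero) + toℚ (b zero)) + (dot c′ (λ i → a (suc i)) + dot c′ (λ i → b (suc i)))
    ≡⟨ solve 5 (λ c x y p q → c :* (x :+ y) :+ (p :+ q) := (c :* x :+ p) :+ (c :* y :+ q)) refl
             (c zero) (toℚ (a zero)) (toℚ (b zero)) _ _ ⟩
  dot c a + dot c b ∎
  where
  open ≡-Reasoning
  open ℚ-Solver
  c′ : Fin d → ℚ
  c′ i = c (suc i)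

0≤p∧0≤q⇒0≤p*q : ∀ {p q} → 0ℚ ℚ.≤ p → 0ℚ ℚ.≤ q → 0ℚ ℚ.≤ p * q
0≤p∧0≤q⇒0≤p*q {p} {q} p≥0 q≥0 =
  subst (ℚ._≤ p * q) (ℚP.*-zeroʳ p) (ℚP.*-monoˡ-≤-nonNeg p {{ℚ.nonNegative p≥0}} q≥0)

dot-nonNeg : ∀ {d} (c : Fin d → ℚ) (v : Fin d → ℕ) → (∀ i → 0ℚ ℚ.≤ c i) → 0ℚ ℚ.≤ dot c (toℤᵛ v)
dot-nonNeg {zero}  c v c≥0 = ℚP.≤-refl
dot-nonNeg {suc d} c v c≥0 = ℚP.+-mono-≤ (0≤p∧0≤q⇒0≤p*q (c≥0 zero) (fromℕ-nonNeg (v zero)))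
  (dot-nonNeg (λ i → c (suc i)) (λ i → v (suc i)) (λ i → c≥0 (suc i)))

dot≤coeffSum* : ∀ {d} (c : Fin d → ℚ) (v : Fin d → ℕ) (s : ℕ) → (∀ i → 0ℚ ℚ.≤ c i) →
  (∀ i → v i ℕ.≤ s) → dot c (toℤᵛ v) ℚ.≤ coeffSum c * fromℕ s
dot≤coeffSum* {zero}  c v s c≥0 v≤s = ℚP.≤-reflexive (sym (ℚP.*-zeroˡ (fromℕ s)))
dot≤coeffSum* {suc d} c v s c≥0 v≤s = ℚP.≤-trans
  (ℚP.+-mono-≤ (ℚP.*-monoˡ-≤-nonNeg (c zero) {{ℚ.nonNegative (c≥0 zero)}} (fromℕ-mono-≤ (v≤s zero)))
               (dot≤coeffSum* (λ i → c (suc i)) (λ i → v (suc i)) s (λ i → c≥0 (suc i)) (λ i → v≤s (suc i))))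
  (ℚP.≤-reflexive (sym (ℚP.*-distribʳ-+ (fromℕ s) (c zero) _)))

coeff*coord≤dot : ∀ {d} (c : Fin d → ℚ) (v : Fin d → ℕ) → (∀ i → 0ℚ ℚ.≤ c i) →
  ∀ i → c i * fromℕ (v i) ℚ.≤ dot c (toℤᵛ v)
coeff*coord≤dot {suc d} c v c≥0 zero = subst (ℚ._≤ dot c (toℤᵛ v)) (ℚP.+-identityʳ _)
  (ℚP.+-monoʳ-≤ (c zero * fromℕ (v zero)) (dot-nonNeg (λ i → c (suc i)) (λ i → v (suc i)) (λ i → c≥0 (suc i))))
coeff*coord≤dot {suc d} c v c≥0 (suc i) = ℚP.≤-trans
  (coeff*coord≤dot (λ i → c (suc i)) (λ i → v (suc i)) (λ i → c≥0 (suc i)) i)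
  (subst (ℚ._≤ dot c (toℤᵛ v)) (ℚP.+-identityˡ _)
     (ℚP.+-monoˡ-≤ (dot (λ i → c (suc i)) (λ i → ℤ.+ v (suc i))) (0≤p∧0≤q⇒0≤p*q (c≥0 zero) (fromℕ-nonNeg (v zero)))))

dot-linearˡ : ∀ {d} (x y : ℚ) (a b : Fin d → ℚ) (e : Fin d → ℤ) →
  dot (λ i → x * a i - y * b i) e ≡ x * dot a e - y * dot b e
dot-linearˡ {zero} x y a b e = solve 2 (λ x y → con 0ℚ := x :* con 0ℚ :- y :* con 0ℚ) refl x y
  where open ℚ-Solver
dot-linearˡ {suc d} x y a b e = ≡.trans
  (cong (_+_ ((x * a zero - y * b zero) * toℚ (e zero)))
        (dot-linearˡ x y (λ i → a (suc i)) (λ i → b (suc i)) (λ i → e (suc i))))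
  (solve 7 (λ x y a b t p q → (x :* a :- y :* b) :* t :+ (x :* p :- y :* q)
                            := x :* (a :* t :+ p) :- y :* (b :* t :+ q))
         refl x y (a zero) (b zero) (toℚ (e zero)) _ _)
  where open ℚ-Solver

dot-punchIn : ∀ {d} (r : Fin (suc d)) (c : Fin (suc d) → ℚ) (e : Fin (suc d) → ℤ) →
  dot c e ≡ c r * toℚ (e r) + dot (λ i → c (punchIn r i)) (λ i → e (punchIn r i))
dot-punchIn zero c e = refl
dot-punchIn {suc d} (suc r) c e = ≡.trans
  (cong (_+_ (c zero * toℚ (e zero))) (dot-punchIn r (λ i → c (suc i)) (λ i → e (suc i))))
  (solve 3 (λ a b p → a :+ (b :+ p) := b :+ (a :+ p)) refl (c zero * toℚ (e zero)) (c (suc r) * toℚ (e (suc r))) _)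
  where open ℚ-Solver

p≢0∧q≢0⇒p*q≢0 : ∀ p q → p ≢ 0ℚ → q ≢ 0ℚ → p * q ≢ 0ℚ
p≢0∧q≢0⇒p*q≢0 p q p≢0 q≢0 pq≡0 = q≢0 (begin
  q                ≡⟨ sym (ℚP.*-identityˡ q) ⟩
  1ℚ * q           ≡⟨ cong (_* q) (sym (ℚP.*-inverseˡ p)) ⟩
  (1/p * p) * q    ≡⟨ ℚP.*-assoc 1/p p q ⟩
  1/p * (p * q)    ≡⟨ cong (1/p *_) pq≡0 ⟩
  1/p * 0ℚ         ≡⟨ ℚP.*-zeroʳ 1/p ⟩
  0ℚ               ∎)
  where
  open ≡-Reasoning
  instance
    p-nonZero : ℚ.NonZero p
    p-nonZero = ℚ.≢-nonZero p≢0
  1/p : ℚ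
  1/p = ℚ.1/ p

nonzero-coeff : ∀ {d} (c : Fin d → ℚ) (e : Fin d → ℤ) → dot c e ≢ 0ℚ → Σ (Fin d) λ r → c r ≢ 0ℚ
nonzero-coeff {zero}  c e dot≢0 = ⊥-elim (dot≢0 refl)
nonzero-coeff {suc d} c e dot≢0 with c zero ℚP.≟ 0ℚ
... | no  c₀≢0 = zero , c₀≢0
... | yes c₀≡0 =
  let (r , cr≢0) = nonzero-coeff (λ i → c (suc i)) (λ i → e (suc i)) λ tail≡0 →
        dot≢0 (≡.trans (cong (λ x → x * toℚ (e zero) + tail) c₀≡0)
                       (≡.trans (solve 2 (λ x y → con 0ℚ :* x :+ y := y) refl (toℚ (e zero)) tail) tail≡0))
  in suc r , cr≢0
  where
  open ℚ-Solver
  tail : ℚ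
  tail = dot (λ i → c (suc i)) (λ i → e (suc i))

-- The vectors e of a triangular list are linearly independent.
data Triangular {d : ℕ} : List ((Fin d → ℚ) × (Fin d → ℤ)) → Set where
  []   : Triangular []
  cons : ∀ {c e ps} → dot c e ≢ 0ℚ → All (λ q → dot c (proj₂ q) ≡ 0ℚ) ps →
         Triangular ps → Triangular ((c , e) ∷ ps)

-- Gaussian elimination of the coordinate r, using the head row c (with c r ≠ 0) as pivot.
module Eliminate {d : ℕ} (r : Fin (suc d)) (c : Fin (suc d) → ℚ) where

  open ℚ-Solver

  reduce : (Fin (suc d) → ℚ) × (Fin (suc d) → ℤ) → (Fin d → ℚ) × (Fin d → ℤ)
  reduce (c′ , e′) = (λ i → c r * c′ (punchIn r i) - c′ r * c (punchIn r i)) , (λ i → e′ (punchIn r i))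

  dot-reduce : ∀ c′ e′ →
    dot (proj₁ (reduce (c′ , e′))) (proj₂ (reduce (c′ , e′))) ≡ c r * dot c′ e′ - c′ r * dot c e′
  dot-reduce c′ e′ = ≡.trans
    (dot-linearˡ (c r) (c′ r) (λ i → c′ (punchIn r i)) (λ i → c (punchIn r i)) e″)
    (≡.trans (solve 5 (λ x y E A B → x :* A :- y :* B := x :* (y :* E :+ A) :- y :* (x :* E :+ B)) refl
                (c r) (c′ r) (toℚ (e′ r)) (dot (λ i → c′ (punchIn r i)) e″) (dot (λ i → c (punchIn r i)) e″))
             (sym (cong₂ (λ u v → c r * u - c′ r * v) (dot-punchIn r c′ e′) (dot-punchIn r c e′))))
    where
    e″ : Fin d → ℤ
    e″ i = e′ (punchIn r i)

  dot-reduce-orthogonal : ∀ c′ e′ → dot c e′ ≡ 0ℚ →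
    dot (proj₁ (reduce (c′ , e′))) (proj₂ (reduce (c′ , e′))) ≡ c r * dot c′ e′
  dot-reduce-orthogonal c′ e′ ce′≡0 = ≡.trans (dot-reduce c′ e′)
    (≡.trans (cong (λ x → c r * dot c′ e′ - c′ r * x) ce′≡0)
             (solve 2 (λ a y → a :- y :* con 0ℚ := a) refl (c r * dot c′ e′) (c′ r)))

  reduce-triangular : c r ≢ 0ℚ → ∀ ps → Triangular ps → All (λ q → dot c (proj₂ q) ≡ 0ℚ) ps →
    Triangular (map reduce ps)
  reduce-triangular cr≢0 [] [] [] = []
  reduce-triangular cr≢0 ((c′ , e′) ∷ ps) (cons c′e′≢0 c′⊥ps tri) (ce′≡0 ∷ c⊥ps) =
    cons (λ eq → p≢0∧q≢0⇒p*q≢0 (c r) (dot c′ e′) cr≢0 c′e′≢0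
                   (≡.trans (sym (dot-reduce-orthogonal c′ e′ ce′≡0)) eq))
         (orthogonal ps c′⊥ps c⊥ps)
         (reduce-triangular cr≢0 ps tri c⊥ps)
    where
    orthogonal : ∀ qs → All (λ q → dot c′ (proj₂ q) ≡ 0ℚ) qs → All (λ q → dot c (proj₂ q) ≡ 0ℚ) qs →
      All (λ q → dot (proj₁ (reduce (c′ , e′))) (proj₂ q) ≡ 0ℚ) (map reduce qs)
    orthogonal [] [] [] = []
    orthogonal ((_ , e) ∷ qs) (c′e≡0 ∷ c′⊥qs) (ce≡0 ∷ c⊥qs) =
      ≡.trans (dot-reduce-orthogonal c′ e ce≡0)
        (≡.trans (cong (c r *_) c′e≡0) (ℚP.*-zeroʳ (c r)))
      ∷ orthogonal qs c′⊥qs c⊥qs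

triangular-length≤dim : ∀ {d} ps → Triangular {d} ps → length ps ℕ.≤ d
triangular-length≤dim [] [] = z≤n
triangular-length≤dim {zero} (_ ∷ _) (cons ce≢0 _ _) = ⊥-elim (ce≢0 refl)
triangular-length≤dim {suc d} ((c , e) ∷ ps) (cons ce≢0 c⊥ps tri) =
  let (r , cr≢0) = nonzero-coeff c e ce≢0
      open Eliminate r c
  in s≤s (subst (ℕ._≤ d) (ListP.length-map reduce ps)
                (triangular-length≤dim (map reduce ps) (reduce-triangular cr≢0 ps tri c⊥ps)))

module _ {m d : ℕ} {Ts : List (Trans m d)} where

  _++ₚ_ : ∀ {x y z} → Path Ts x y → Path Ts y z → Path Ts x z
  one t∈Ts    ++ₚ ρ = cons t∈Ts ρ
  cons t∈Ts π ++ₚ ρ = cons t∈Ts (π ++ₚ ρ)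

  departs : ∀ {x y} → Path Ts x y → Any (λ t → src t ≡ x) Ts
  departs (one t∈Ts)    = lose t∈Ts refl
  departs (cons t∈Ts _) = lose t∈Ts refl

  Reach : Fin m → Fin m → Set
  Reach x y = x ≡ y ⊎ Path Ts x y

  reach-++ₚ : ∀ {x y z} → Reach x y → Path Ts y z → Path Ts x z
  reach-++ₚ (inj₁ refl) ρ = ρ
  reach-++ₚ (inj₂ π)    ρ = π ++ₚ ρ

  ++ₚ-reach : ∀ {x y z} → Path Ts x y → Reach y z → Path Ts x z
  ++ₚ-reach π (inj₁ refl) = π
  ++ₚ-reach π (inj₂ ρ)    = π ++ₚ ρ

  reach-trans : ∀ {x y z} → Reach x y → Reach y z → Reach x z
  reach-trans (inj₁ refl) ρ = ρ
  reach-trans (inj₂ π)    ρ = inj₂ (++ₚ-reach π ρ)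

path-map : ∀ {m d} {Ts Ts′ : List (Trans m d)} → Ts ⊆ Ts′ → ∀ {x y} → Path Ts x y → Path Ts′ x y
path-map Ts⊆Ts′ (one t∈Ts)    = one (Ts⊆Ts′ t∈Ts)
path-map Ts⊆Ts′ (cons t∈Ts π) = cons (Ts⊆Ts′ t∈Ts) (path-map Ts⊆Ts′ π)

-- Depth-first search: a path from x with all sources in L exists iff some transition out of x
-- reaches q or leads to a path within L without x; for the converse, cut at the last departure from x.
module PathSearch {m d : ℕ} (G : List (Trans m d)) where

  open DecMembership (Fin._≟_ {m}) using (_∈?_)

  Sources : (Fin m → Set) → ∀ {x y} → Path G x y → Set
  Sources P (one {t} _)    = P (src t)
  Sources P (cons {t} _ π) = P (src t) × Sources P π

  sources-map : ∀ {P Q : Fin m → Set} → (∀ {z} → P z → Q z) → ∀ {x y} (π : Path G x y) → Sources P π → Sources Q π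
  sources-map P⇒Q (one _)    Pt          = P⇒Q Pt
  sources-map P⇒Q (cons _ π) (Pt , Pπ)   = P⇒Q Pt , sources-map P⇒Q π Pπ

  sources-all : ∀ {P : Fin m → Set} → (∀ z → P z) → ∀ {x y} (π : Path G x y) → Sources P π
  sources-all P-all (one _)    = P-all _
  sources-all P-all (cons _ π) = P-all _ , sources-all P-all π

  sources-head : ∀ {P : Fin m → Set} {x y} (π : Path G x y) → Sources P π → P x
  sources-head (one _)    Pt       = Pt
  sources-head (cons _ _) (Pt , _) = Pt

  remove : Fin m → List (Fin m) → List (Fin m)
  remove x = filter (λ z → ¬? (z Fin.≟ x))

  remove-shrinks : ∀ {x} L → x ∈ L → length (remove x L) ℕ.< length L
  remove-shrinks {x} L x∈L = ListP.filter-notAll (λ z → ¬? (z Fin.≟ x)) L (Any.map (λ x≡z z≢x → z≢x (sym x≡z)) x∈L)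

  PathIn : List (Fin m) → Fin m → Fin m → Set
  PathIn L x q = Σ (Path G x q) (Sources (_∈ L))

  Departure : List (Fin m) → Fin m → Fin m → Set
  Departure L x q = Σ (Trans m d) λ t → t ∈ G × src t ≡ x × (tgt t ≡ q ⊎ PathIn (remove x L) (tgt t) q)

  last-departure : ∀ {L} x {y q} (π : Path G y q) → Sources (_∈ L) π →
    Sources (λ z → z ∈ L × z ≢ x) π ⊎ Departure L x q
  last-departure x (one {t} t∈G) src∈L with src t Fin.≟ x
  ... | yes src≡x = inj₂ (t , t∈G , src≡x , inj₁ refl)
  ... | no  src≢x = inj₁ (src∈L , src≢x)
  last-departure x (cons {t} t∈G π) (src∈L , π⊆L) with last-departure x π π⊆L
  ... | inj₂ dep = inj₂ dep
  ... | inj₁ π∌x with src t Fin.≟ x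
  ...   | yes src≡x = inj₂ (t , t∈G , src≡x , inj₂ (π , sources-map (λ (z∈L , z≢x) → ∈-filter⁺ _ z∈L z≢x) π π∌x))
  ...   | no  src≢x = inj₁ ((src∈L , src≢x) , π∌x)

  departure : ∀ {L x q} → PathIn L x q → Departure L x q
  departure {x = x} (π , π⊆L) with last-departure x π π⊆L
  ... | inj₂ dep  = dep
  ... | inj₁ π∌x = ⊥-elim (proj₂ (sources-head π π∌x) refl)

  from-departure : ∀ {L x q} → x ∈ L → Departure L x q → PathIn L x q
  from-departure x∈L (t , t∈G , refl , inj₁ refl) = one t∈G , x∈L
  from-departure x∈L (t , t∈G , refl , inj₂ (π , π⊆L)) =
    cons t∈G π , x∈L , sources-map (λ z∈L′ → proj₁ (∈-filter⁻ _ z∈L′)) π π⊆L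

  pathIn? : ∀ n L → length L ℕ.≤ n → ∀ x q → Dec (PathIn L x q)
  pathIn? n L |L|≤n x q with x ∈? L
  ... | no x∉L = no λ (π , π⊆L) → x∉L (sources-head π π⊆L)
  pathIn? zero (_ ∷ _) () x q | yes _
  pathIn? (suc n) L |L|≤n x q | yes x∈L
    with any? (λ t → (src t Fin.≟ x) ×-dec ((tgt t Fin.≟ q) ⊎-dec
                       pathIn? n (remove x L) (ℕP.≤-pred (ℕP.<-≤-trans (remove-shrinks L x∈L) |L|≤n)) (tgt t) q)) G
  ... | yes dep = let (t , t∈G , rest) = find dep in yes (from-departure x∈L (t , t∈G , rest))
  ... | no ¬dep = no λ πL → let (t , t∈G , rest) = departure πL in ¬dep (lose t∈G rest)

  path? : ∀ x q → Dec (Path G x q)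
  path? x q with pathIn? m (allFin m) (length-allFin m) x q
  ... | yes (π , _) = yes π
  ... | no ¬π       = no λ π → ¬π (π , sources-all ∈-allFin π)

source∈states : ∀ {m d} {A : VASS m d} → IsVASS A → ∀ {x y} → Path (trans A) x y → x ∈ states A
source∈states vA (one t∈A)    = proj₁ (All.lookup (IsVASS.endpoints vA) t∈A)
source∈states vA (cons t∈A _) = proj₁ (All.lookup (IsVASS.endpoints vA) t∈A)

module Components {m d : ℕ} (B : VASS m d) (vB : IsVASS B) (G : List (Trans m d))
                  (uniqueG : Unique G) (G⊆B : G ⊆ trans B) where

  open PathSearch G using (path?)

  Linked : Fin m → Fin m → Set
  Linked p x = Reach {Ts = G} p x × Reach {Ts = G} x p

  linked? : ∀ p x → Dec (Linked p x)
  linked? p x = reach? p x ×-dec reach? x p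
    where
    reach? : ∀ x y → Dec (Reach {Ts = G} x y)
    reach? x y = (x Fin.≟ y) ⊎-dec path? x y

  linkedTrans? : ∀ p (t : Trans m d) → Dec (Linked p (src t) × Linked p (tgt t))
  linkedTrans? p t = linked? p (src t) ×-dec linked? p (tgt t)

  component : Fin m → VASS m d
  component p = vass (filter (linked? p) (allFin m)) (filter (linkedTrans? p) G)

  module _ {p : Fin m} where

    ∈-component⁺ : ∀ {x} → Linked p x → x ∈ states (component p)
    ∈-component⁺ {x} = ∈-filter⁺ (linked? p) (∈-allFin x)

    ∈-component⁻ : ∀ {x} → x ∈ states (component p) → Linked p x
    ∈-component⁻ x∈C = proj₂ (∈-filter⁻ (linked? p) {xs = allFin m} x∈C)

    ∈-componentTrans⁺ : ∀ {t} → t ∈ G → Linked p (src t) → Linked p (tgt t) → t ∈ trans (component p)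
    ∈-componentTrans⁺ t∈G ls lt = ∈-filter⁺ (linkedTrans? p) t∈G (ls , lt)

    ∈-componentTrans⁻ : ∀ {t} → t ∈ trans (component p) → t ∈ G × Linked p (src t) × Linked p (tgt t)
    ∈-componentTrans⁻ t∈C = ∈-filter⁻ (linkedTrans? p) {xs = G} t∈C

    lift : ∀ {x y} → Path G x y → Linked p x → Reach y p → Path (trans (component p)) x y
    lift (one t∈G) lx y→p =
      one (∈-componentTrans⁺ t∈G lx (reach-trans (proj₁ lx) (inj₂ (one t∈G)) , y→p))
    lift (cons t∈G π) lx y→p =
      let lt = reach-trans (proj₁ lx) (inj₂ (one t∈G)) , inj₂ (++ₚ-reach π y→p)
      in cons (∈-componentTrans⁺ t∈G lx lt) (lift π lt y→p)

  module _ (p : Fin m) (cycle : Path G p p) where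

    linked-path : ∀ {x y} → Linked p x → Linked p y → Path G x y
    linked-path (_ , x→p) (p→y , _) = reach-++ₚ x→p (++ₚ-reach cycle p→y)

    component-isSCC : IsSCC (states B) G (component p)
    component-isSCC = record
      { isVASS = record
        { nonempty  = ∈⇒≢[] p∈C
        ; uniqQ     = Unique.filter⁺ (linked? p) (Unique.allFin⁺ m)
        ; uniqT     = Unique.filter⁺ _ uniqueG
        ; endpoints = All.tabulate endpoints
        ; outgoing  = All.tabulate λ x∈C →
            let lx = ∈-component⁻ x∈C in departs (lift (linked-path lx lx) lx (proj₂ lx))
        }
      ; sub = record
        { statesSub = λ x∈C → let lx = ∈-component⁻ x∈C in
                        source∈states vB (path-map G⊆B (linked-path lx lx))
        ; transSub  = λ t∈C → proj₁ (∈-componentTrans⁻ t∈C)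
        ; inside    = All.tabulate endpoints
        }
      ; sc      = λ x y x∈C y∈C → let lx = ∈-component⁻ x∈C ; ly = ∈-component⁻ y∈C in
                    lift (linked-path lx ly) lx (proj₂ ly)
      ; maximal = maximal
      }
      where
      p∈C : p ∈ states (component p)
      p∈C = ∈-component⁺ (inj₁ refl , inj₁ refl)

      endpoints : ∀ {t} → t ∈ trans (component p) → (src t ∈ states (component p)) × (tgt t ∈ states (component p))
      endpoints t∈C = let (_ , ls , lt) = ∈-componentTrans⁻ t∈C in ∈-component⁺ ls , ∈-component⁺ lt

      maximal : ∀ B′ → SubVASS (states B) G B′ → StronglyConnected B′ → component p ⊑ B′ → B′ ⊑ component p
      maximal B′ sub′ sc′ (C⊆B′ , _) = linked∈C , λ t∈B′ →
          let (s∈B′ , t∈B′′) = All.lookup (SubVASS.inside sub′) t∈B′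
          in ∈-componentTrans⁺ (SubVASS.transSub sub′ t∈B′) (linked s∈B′) (linked t∈B′′)
        where
        linked : ∀ {x} → x ∈ states B′ → Linked p x
        linked x∈B′ = inj₂ (path-map (SubVASS.transSub sub′) (sc′ _ _ (C⊆B′ p∈C) x∈B′))
                    , inj₂ (path-map (SubVASS.transSub sub′) (sc′ _ _ x∈B′ (C⊆B′ p∈C)))
        linked∈C : ∀ {x} → x ∈ states B′ → x ∈ states (component p)
        linked∈C x∈B′ = ∈-component⁺ (linked x∈B′)

size-≥ : ∀ {d} (v : Fin d → ℕ) i → v i ℕ.≤ size v
size-≥ v zero    = ℕP.m≤m⊔n _ _
size-≥ v (suc i) = ℕP.≤-trans (size-≥ (λ i → v (suc i)) i) (ℕP.m≤n⊔m _ _)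

size-lub : ∀ {d} (v : Fin d → ℕ) {s} → (∀ i → v i ℕ.≤ s) → size v ℕ.≤ s
size-lub {zero}  v v≤s = z≤n
size-lub {suc d} v v≤s = ℕP.⊔-lub (v≤s zero) (size-lub (λ i → v (suc i)) (λ i → v≤s (suc i)))

Within : ∀ {m d} {A : VASS m d} {p v n} → ℕ → ℕ → Comp A p v n → Set
Within {v = v} g s stop                 = size v ℕ.≤ s
Within {v = v} g s (step _ _ _ _ π)     = size v ℕ.≤ s × Within g (g ℕ.+ s) π

within-head : ∀ {m d} {A : VASS m d} {p v n g s} (π : Comp A p v n) → Within g s π → size v ℕ.≤ s
within-head stop                 W       = W
within-head (step _ _ _ _ _)     (W , _) = W

within-mono : ∀ {m d} {A : VASS m d} {p v n g s s′} → s ℕ.≤ s′ → (π : Comp A p v n) → Within g s π → Within g s′ π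
within-mono s≤s′ stop               W       = ℕP.≤-trans W s≤s′
within-mono s≤s′ (step _ _ _ _ π)   (W , Wπ) = ℕP.≤-trans W s≤s′ , within-mono (ℕP.+-monoʳ-≤ _ s≤s′) π Wπ

LengthBoundAt : ∀ {m d} → VASS m d → (g s n : ℕ) → Set
LengthBoundAt {m} {d} A g s n = ∀ {p : Fin m} {v : Fin d → ℕ} {len} (π : Comp A p v len) → Within g s π → len ℕ.≤ n

LengthBound : ∀ {m d} → VASS m d → ℕ → (ℕ → ℕ) → Set
LengthBound A g b = ∀ s → LengthBoundAt A g s (b s)

size-step : ∀ {d} {v w : Fin d → ℕ} {u : Fin d → ℤ} {U} → (∀ i → ℤ.+ w i ≡ ℤ.+ v i ℤ.+ u i) →
  (∀ i → ℤ.∣ u i ∣ ℕ.≤ U) → size w ℕ.≤ size v ℕ.+ U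
size-step {v = v} {w} {u} w≡v+u u≤U = size-lub w λ i →
  ℕP.≤-trans (subst (ℕ._≤ v i ℕ.+ ℤ.∣ u i ∣) (cong ℤ.∣_∣ (sym (w≡v+u i)))
                    (ℤP.∣i+j∣≤∣i∣+∣j∣ (ℤ.+ v i) (u i)))
             (ℕP.+-mono-≤ (size-≥ v i) (u≤U i))

updateBound : ∀ {m d} → VASS m d → ℕ
updateBound A = proj₁ (bounded-above (λ t → size (λ i → ℤ.∣ upd t i ∣)) (trans A))

within-updateBound : ∀ {m d} {A : VASS m d} {p v n s} → size v ℕ.≤ s → (π : Comp A p v n) → Within (updateBound A) s π
within-updateBound v≤s stop = v≤s
within-updateBound {A = A} v≤s (step t t∈A _ w≡v+u π) =
  v≤s , within-updateBound (ℕP.≤-trans (size-step {u = upd t} w≡v+u u≤U)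
                                       (ℕP.≤-trans (ℕP.+-monoˡ-≤ _ v≤s) (ℕP.≤-reflexive (ℕP.+-comm _ (updateBound A))))) π
  where
  u≤U : ∀ i → ℤ.∣ upd t i ∣ ℕ.≤ updateBound A
  u≤U i = ℕP.≤-trans (size-≥ (λ i → ℤ.∣ upd t i ∣) i)
                     (proj₂ (bounded-above (λ t → size (λ i → ℤ.∣ upd t i ∣)) (trans A)) t∈A)

module Potential {m d : ℕ} (f : LinMap m d) (c≥0 : ∀ i → 0ℚ ℚ.≤ c f i) where

  open ℚ-Solver

  potential : Fin m → (Fin d → ℕ) → ℚ
  potential p v = dot (c f) (toℤᵛ v) + w f p

  module _ {t : Trans m d} {v v′ : Fin d → ℕ} (v′≡v+u : ∀ i → ℤ.+ v′ i ≡ ℤ.+ v i ℤ.+ upd t i) where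

    potential-step : potential (tgt t) v′ ≡ potential (src t) v + (lhs f t - w f (src t))
    potential-step = ≡.trans
      (cong (_+ w f (tgt t)) (≡.trans (dot-cong (c f) v′≡v+u) (dot-homo-+ (c f) (toℤᵛ v) (upd t))))
      (solve 4 (λ a b x y → (a :+ b) :+ x := (a :+ y) :+ ((b :+ x) :- y)) refl
             (dot (c f) (toℤᵛ v)) (dot (c f) (upd t)) (w f (tgt t)) (w f (src t)))

    potential-ranked : Ranked f t → potential (tgt t) v′ ℚ.≤ potential (src t) v - 1ℚ
    potential-ranked ranked = ≡.subst₂ ℚ._≤_ (sym potential-step)
      (solve 2 (λ a y → a :+ ((y :- con 1ℚ) :- y) := a :- con 1ℚ) refl (potential (src t) v) (w f (src t)))
      (ℚP.+-monoʳ-≤ (potential (src t) v) (ℚP.+-monoˡ-≤ (ℚ.- w f (src t)) ranked))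

    potential-neutral : Neutral f t → potential (tgt t) v′ ≡ potential (src t) v
    potential-neutral neutral = ≡.trans potential-step
      (≡.trans (cong (λ x → potential (src t) v + (x - w f (src t))) neutral)
               (solve 2 (λ a y → a :+ (y :- y) := a) refl (potential (src t) v) (w f (src t))))

    potential-nonincreasing : Ranked f t ⊎ Neutral f t → potential (tgt t) v′ ℚ.≤ potential (src t) v
    potential-nonincreasing (inj₁ ranked)  = ℚP.≤-trans (potential-ranked ranked) (ℚP.<⇒≤ (p-1<p _))
    potential-nonincreasing (inj₂ neutral) = ℚP.≤-reflexive (potential-neutral neutral)

  -- Ranked transitions lower the potential by a level and no configuration lies below level 0,
  -- so from potential below level K fewer than K ranked transitions can follow.
  wₗ wₕ : ℚ
  wₗ = proj₁ (ℚ-bounded-below (w f))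
  wₕ = proj₁ (ℚ-bounded-above (w f))

  level : ℕ → ℚ
  level K = wₗ + fromℕ K

  level-suc : ∀ K → level (suc K) ≡ level K + 1ℚ
  level-suc K = ≡.trans (cong (wₗ +_) (fromℕ-suc K)) (sym (ℚP.+-assoc wₗ (fromℕ K) 1ℚ))

  level<level-suc : ∀ K → level K ℚ.< level (suc K)
  level<level-suc K = subst (level K ℚ.<_) (sym (level-suc K)) (p<p+1 (level K))

  wₗ≤w : ∀ p → wₗ ℚ.≤ w f p
  wₗ≤w = proj₂ (ℚ-bounded-below (w f))

  wₗ≤potential : ∀ p v → wₗ ℚ.≤ potential p v
  wₗ≤potential p v = subst (ℚ._≤ potential p v) (ℚP.+-identityˡ wₗ)
    (ℚP.+-mono-≤ (dot-nonNeg (c f) v c≥0) (wₗ≤w p))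

  potential≮level0 : ∀ p v → ¬ (potential p v ℚ.< level 0)
  potential≮level0 p v pot<wₗ+0 = ℚP.<-irrefl refl
    (ℚP.≤-<-trans (wₗ≤potential p v) (subst (potential p v ℚ.<_) (ℚP.+-identityʳ wₗ) pot<wₗ+0))

  potential<level-ranked : ∀ {t v v′ K} → (∀ i → ℤ.+ v′ i ≡ ℤ.+ v i ℤ.+ upd t i) → Ranked f t →
    potential (src t) v ℚ.< level (suc K) → potential (tgt t) v′ ℚ.< level K
  potential<level-ranked {t} {v} {K = K} v′≡v+u ranked pot<level = ℚP.≤-<-trans (potential-ranked v′≡v+u ranked)
    (subst (potential (src t) v - 1ℚ ℚ.<_)
           (≡.trans (cong (_- 1ℚ) (level-suc K)) (solve 1 (λ l → l :+ con 1ℚ :- con 1ℚ := l) refl (level K)))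
           (ℚP.+-monoˡ-< (ℚ.- 1ℚ) pot<level))

  α β : ℕ
  α = proj₁ (archimedean (coeffSum (c f)))
  β = proj₁ (archimedean (wₕ - wₗ))

  initialLevel : ℕ → ℕ
  initialLevel s = suc (α ℕ.* s ℕ.+ β)

  potential<initialLevel : ∀ p {v s} → size v ℕ.≤ s → potential p v ℚ.< level (initialLevel s)
  potential<initialLevel p {v} {s} v≤s = begin-strict
    potential p v                       ≤⟨ ℚP.+-mono-≤ (dot≤coeffSum* (c f) v s c≥0 (λ i → ℕP.≤-trans (size-≥ v i) v≤s))
                                                       (proj₂ (ℚ-bounded-above (w f)) p) ⟩
    coeffSum (c f) * fromℕ s + wₕ       ≤⟨ ℚP.+-mono-≤ (ℚP.*-monoʳ-≤-nonNeg (fromℕ s) {{ℚ.nonNegative (fromℕ-nonNeg s)}}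
                                                          (proj₂ (archimedean (coeffSum (c f)))))
                                                       wₕ≤β+wₗ ⟩
    fromℕ α * fromℕ s + (fromℕ β + wₗ)  ≡⟨ solve 4 (λ a s b w → a :* s :+ (b :+ w) := w :+ (a :* s :+ b)) refl
                                                  (fromℕ α) (fromℕ s) (fromℕ β) wₗ ⟩
    wₗ + (fromℕ α * fromℕ s + fromℕ β)  ≡⟨ cong (wₗ +_) (sym (≡.trans (fromℕ-homo-+ (α ℕ.* s) β)
                                                                     (cong (_+ fromℕ β) (fromℕ-homo-* α s)))) ⟩
    level (α ℕ.* s ℕ.+ β)               <⟨ level<level-suc (α ℕ.* s ℕ.+ β) ⟩
    level (initialLevel s)              ∎
    where
    open ℚP.≤-Reasoning
    wₕ≤β+wₗ : wₕ ℚ.≤ fromℕ β + wₗ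
    wₕ≤β+wₗ = subst (ℚ._≤ fromℕ β + wₗ) (solve 2 (λ a b → a :- b :+ b := a) refl wₕ wₗ)
                    (ℚP.+-monoˡ-≤ wₗ (proj₂ (archimedean (wₕ - wₗ))))

-- K bounds the potential level and l the number of states still reachable; each phase spends at
-- most b s steps in one component, after which the size has grown by at most g per step.
budget : (m g : ℕ) (b : ℕ → ℕ) → ℕ → ℕ → ℕ → ℕ
budget m g b zero    l       s = 0
budget m g b (suc K) zero    s = 0
budget m g b (suc K) (suc l) s = b s ℕ.+ suc (budget m g b K m s′ ⊔ budget m g b (suc K) l s′)
  where s′ = g ℕ.* suc (b s) ℕ.+ s

budget-static : ∀ m b K l s → budget m 0 b K l s ℕ.≤ (K ℕ.* suc m ℕ.+ l) ℕ.* suc (b s)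
budget-static m b zero    l       s = z≤n
budget-static m b (suc K) zero    s = z≤n
budget-static m b (suc K) (suc l) s = begin
  b s ℕ.+ suc (budget m 0 b K m s ⊔ budget m 0 b (suc K) l s)
    ≤⟨ ℕP.+-monoʳ-≤ (b s) (s≤s (ℕP.⊔-lub
         (ℕP.≤-trans (budget-static m b K m s) (ℕP.*-monoˡ-≤ (suc (b s)) K*m′+m≤))
         (budget-static m b (suc K) l s))) ⟩
  b s ℕ.+ suc ((suc K ℕ.* suc m ℕ.+ l) ℕ.* suc (b s))
    ≡⟨ solve 3 (λ x l b → b :+ (con 1 :+ (x :+ l) :* (con 1 :+ b)) := (x :+ (con 1 :+ l)) :* (con 1 :+ b))
             refl (suc K ℕ.* suc m) l (b s) ⟩
  (suc K ℕ.* suc m ℕ.+ suc l) ℕ.* suc (b s) ∎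
  where
  open ℕP.≤-Reasoning
  open ℕ-Solver
  K*m′+m≤ : K ℕ.* suc m ℕ.+ m ℕ.≤ suc K ℕ.* suc m ℕ.+ l
  K*m′+m≤ = ℕP.≤-trans (ℕP.≤-reflexive (ℕP.+-comm (K ℕ.* suc m) m))
                       (ℕP.≤-trans (ℕP.n≤1+n _) (ℕP.m≤m+n _ l))

growth-after-prefix : ∀ {ℓ b} g s → ℓ ℕ.≤ b → g ℕ.+ (ℓ ℕ.* g ℕ.+ s) ℕ.≤ g ℕ.* suc b ℕ.+ s
growth-after-prefix {ℓ} {b} g s ℓ≤b = begin
  g ℕ.+ (ℓ ℕ.* g ℕ.+ s)  ≤⟨ ℕP.+-monoʳ-≤ g (ℕP.+-monoˡ-≤ s (ℕP.*-monoˡ-≤ g ℓ≤b)) ⟩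
  g ℕ.+ (b ℕ.* g ℕ.+ s)  ≡⟨ solve 3 (λ b g s → g :+ (b :* g :+ s) := g :* (con 1 :+ b) :+ s) refl b g s ⟩
  g ℕ.* suc b ℕ.+ s      ∎
  where
  open ℕP.≤-Reasoning
  open ℕ-Solver

module DecomposeRound {m d : ℕ} (B : VASS m d) (vB : IsVASS B) (f : LinMap m d) (qrf : IsQRF B f) where

  G : List (Trans m d)
  G = neutralTrans B f

  G⊆B : ∀ {t} → t ∈ G → t ∈ trans B
  G⊆B t∈G = proj₁ (∈-filter⁻ (neutral? f) {xs = trans B} t∈G)

  neutral∈G : ∀ {t} → t ∈ trans B → Neutral f t → t ∈ G
  neutral∈G = ∈-filter⁺ (neutral? f)

  open Components B vB G (Unique.filter⁺ (neutral? f) (IsVASS.uniqT vB)) G⊆B public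
  open Potential f (proj₁ qrf) public

  ranked-or-neutral : ∀ {t} → t ∈ trans B → Ranked f t ⊎ Neutral f t
  ranked-or-neutral = All.lookup (proj₂ qrf)

  module _ (p : Fin m) where

    Leaves : ∀ {y v n} → Comp B y v n → Set
    Leaves stop               = ⊤
    Leaves (step t _ _ _ _)   = ¬ (Neutral f t × Linked p (tgt t))

    record Split {x v len} (π : Comp B x v len) : Set where
      field
        {ℓ rest-len} : ℕ
        {y}          : Fin m
        {v′}         : Fin d → ℕ
        prefix       : Comp (component p) x v ℓ
        rest         : Comp B y v′ rest-len
        length-sum   : len ≡ ℓ ℕ.+ rest-len
        linked       : Linked p y
        potential≡   : potential y v′ ≡ potential x v
        leaves       : Leaves rest
        within       : ∀ {g s} → Within g s π → Within g s prefix × Within g (ℓ ℕ.* g ℕ.+ s) rest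

    split : ∀ {x v len} (π : Comp B x v len) → Linked p x → Split π
    split stop lx = record
      { prefix = stop ; rest = stop ; length-sum = refl ; linked = lx ; potential≡ = refl
      ; leaves = _ ; within = λ W → W , W }
    split π@(step t t∈B w w≡v+u π′) lx with neutral? f t ×-dec linked? p (tgt t)
    ... | no leaves = record
      { prefix = stop ; rest = π ; length-sum = refl ; linked = lx ; potential≡ = refl
      ; leaves = leaves ; within = λ W → within-head π W , W }
    ... | yes (neutral , lt) = record
      { prefix     = step t (∈-componentTrans⁺ (neutral∈G t∈B neutral) lx lt) w w≡v+u prefix
      ; rest       = rest
      ; length-sum = cong suc length-sum
      ; linked     = linked
      ; potential≡ = ≡.trans potential≡ (potential-neutral w≡v+u neutral)
      ; leaves     = leaves
      ; within     = λ { {g} {s} (Wv , Wπ′) →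
          let (Wpre , Wrest) = within Wπ′
          in (Wv , Wpre) , within-mono (ℕP.≤-reflexive (shift g s ℓ)) rest Wrest }
      }
      where
      open Split (split π′ lt)
      shift : ∀ g s ℓ → ℓ ℕ.* g ℕ.+ (g ℕ.+ s) ≡ suc ℓ ℕ.* g ℕ.+ s
      shift = solve 3 (λ g s ℓ → ℓ :* g :+ (g :+ s) := (con 1 :+ ℓ) :* g :+ s) refl
        where open ℕ-Solver

  module _ (g : ℕ) (b : ℕ → ℕ) (component-bound : ∀ q → Path G q q → LengthBound (component q) g b) where

    open PathSearch G using (remove; remove-shrinks)

    prefix-length : ∀ {p x v ℓ s} (π : Comp (component p) x v ℓ) → Within g s π → ℓ ℕ.≤ b s
    prefix-length stop _ = z≤n
    prefix-length {p} {s = s} π@(step t t∈C _ _ _) W = component-bound p cycle s π W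
      where
      cycle : Path G p p
      cycle = let (t∈G , ls , lt) = ∈-componentTrans⁻ t∈C
              in reach-++ₚ (proj₁ ls) (++ₚ-reach (one t∈G) (proj₂ lt))

    Bounded : ℕ → ℕ → Set
    Bounded K l = ∀ s (L : List (Fin m)) → length L ℕ.≤ l → ∀ {p v len} (π : Comp B p v len) →
      potential p v ℚ.< level K → (∀ {z} → Reach {Ts = G} p z → z ∈ L) → Within g s π →
      len ℕ.≤ budget m g b K l s

    bounded-step : ∀ K l → Bounded K m → Bounded (suc K) l → Bounded (suc K) (suc l)
    bounded-step K l bounded-K bounded-l s L |L|≤1+l {p} π pot<level reach⊆L W =
      subst (ℕ._≤ budget m g b (suc K) (suc l) s) (sym length-sum)
        (ℕP.+-mono-≤ ℓ≤b (after-leaving rest leaves linked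
           (subst (ℚ._< level (suc K)) (sym potential≡) pot<level) (proj₂ (within W))))
      where
      open Split (split p π (inj₁ refl , inj₁ refl))

      ℓ≤b : ℓ ℕ.≤ b s
      ℓ≤b = prefix-length prefix (proj₁ (within W))

      s′ : ℕ
      s′ = g ℕ.* suc (b s) ℕ.+ s

      after-leaving : ∀ {y v n} (ρ : Comp B y v n) → Leaves p ρ → Linked p y → potential y v ℚ.< level (suc K) →
        Within g (ℓ ℕ.* g ℕ.+ s) ρ → n ℕ.≤ suc (budget m g b K m s′ ⊔ budget m g b (suc K) l s′)
      after-leaving stop _ _ _ _ = z≤n
      after-leaving (step {n = n} t t∈B _ w≡v+u ρ) leaves ly pot<level (_ , Wρ) =
        s≤s (after-step (ranked-or-neutral t∈B))
        where
        Wρ′ : Within g s′ ρ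
        Wρ′ = within-mono (growth-after-prefix g s ℓ≤b) ρ Wρ

        after-step : Ranked f t ⊎ Neutral f t → n ℕ.≤ budget m g b K m s′ ⊔ budget m g b (suc K) l s′
        after-step (inj₁ ranked) = ℕP.≤-trans
          (bounded-K s′ (allFin m) (length-allFin m) ρ
             (potential<level-ranked {K = K} w≡v+u ranked pot<level) (λ {z} _ → ∈-allFin z) Wρ′)
          (ℕP.m≤m⊔n _ _)
        after-step (inj₂ neutral) = ℕP.≤-trans
          (bounded-l s′ (remove (src t) L)
             (ℕP.≤-pred (ℕP.<-≤-trans (remove-shrinks L (reach⊆L (proj₁ ly))) |L|≤1+l)) ρ
             (subst (ℚ._< level (suc K)) (sym (potential-neutral w≡v+u neutral)) pot<level)
             (λ r → ∈-filter⁺ _ (reach⊆L (reach-trans (proj₁ ly) (inj₂ (++ₚ-reach (one t∈G) r)))) (≢src r))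
             Wρ′)
          (ℕP.m≤n⊔m _ _)
          where
          t∈G : t ∈ G
          t∈G = neutral∈G t∈B neutral
          -- returning to src t would put tgt t into the component, but t leaves it
          ≢src : ∀ {z} → Reach {Ts = G} (tgt t) z → z ≢ src t
          ≢src r refl = leaves (neutral , reach-trans (proj₁ ly) (inj₂ (one t∈G)) , reach-trans r (proj₂ ly))

    bounded : ∀ K l → Bounded K l
    bounded zero    l       s L _ {p} {v} π pot<level _ _ = ⊥-elim (potential≮level0 p v pot<level)
    bounded (suc K) zero    s [] _ π _ reach⊆L _ with reach⊆L (inj₁ refl)
    ... | ()
    bounded (suc K) (suc l) = bounded-step K l (bounded K m) (bounded (suc K) l)

    length-bound : LengthBound B g (λ s → budget m g b (initialLevel s) m s)
    length-bound s {p} π W =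
      bounded (initialLevel s) m s (allFin m) (length-allFin m) π
        (potential<initialLevel p (within-head π W)) (λ {z} _ → ∈-allFin z) W

module _ {m d : ℕ} {Ts : List (Trans m d)} where

  effect : ∀ {x y} → Path Ts x y → Fin d → ℤ
  effect (one {t} _)    = upd t
  effect (cons {t} _ π) = λ i → upd t i ℤ.+ effect π i

  effect-cons : ∀ (f : LinMap m d) {t y} (t∈Ts : t ∈ Ts) (π : Path Ts (tgt t) y) →
    dot (c f) (effect (cons t∈Ts π)) + w f y ≡ dot (c f) (upd t) + (dot (c f) (effect π) + w f y)
  effect-cons f {t} t∈Ts π = ≡.trans (cong (_+ w f _) (dot-homo-+ (c f) (upd t) (effect π)))
                                     (ℚP.+-assoc (dot (c f) (upd t)) _ _)

  neutral-path-effect : (f : LinMap m d) → (∀ {t} → t ∈ Ts → Neutral f t) →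
    ∀ {x y} (π : Path Ts x y) → dot (c f) (effect π) + w f y ≡ w f x
  neutral-path-effect f neutral (one t∈Ts)    = neutral t∈Ts
  neutral-path-effect f neutral (cons {t} t∈Ts π) = ≡.trans (effect-cons f t∈Ts π)
    (≡.trans (cong (dot (c f) (upd t) +_) (neutral-path-effect f neutral π)) (neutral t∈Ts))

  qrf-path-effect : (f : LinMap m d) → All (λ t → Ranked f t ⊎ Neutral f t) Ts →
    ∀ {x y} (π : Path Ts x y) → dot (c f) (effect π) + w f y ℚ.≤ w f x
  qrf-path-effect f qrf (one t∈Ts) with All.lookup qrf t∈Ts
  ... | inj₁ ranked  = ℚP.≤-trans ranked (ℚP.<⇒≤ (p-1<p _))
  ... | inj₂ neutral = ℚP.≤-reflexive neutral
  qrf-path-effect f qrf (cons {t} t∈Ts π) = ℚP.≤-trans (ℚP.≤-reflexive (effect-cons f t∈Ts π))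
    (ℚP.≤-trans (ℚP.+-monoʳ-≤ (dot (c f) (upd t)) (qrf-path-effect f qrf π)) (qrf-path-effect f qrf (one t∈Ts)))

  ranked-cycle-effect : (f : LinMap m d) → All (λ t → Ranked f t ⊎ Neutral f t) Ts →
    ∀ {t} (t∈Ts : t ∈ Ts) → Ranked f t → (π : Path Ts (tgt t) (src t)) → dot (c f) (effect (cons t∈Ts π)) ≢ 0ℚ
  ranked-cycle-effect f qrf {t} t∈Ts ranked π effect≡0 = ℚP.<-irrefl refl (ℚP.≤-<-trans w≤w-1 (p-1<p (w f (src t))))
    where
    w≤w-1 : w f (src t) ℚ.≤ w f (src t) - 1ℚ
    w≤w-1 = subst (ℚ._≤ w f (src t) - 1ℚ) (≡.trans (cong (_+ w f (src t)) effect≡0) (ℚP.+-identityˡ _))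
      (ℚP.≤-trans (ℚP.≤-reflexive (effect-cons f t∈Ts π))
        (ℚP.≤-trans (ℚP.+-monoʳ-≤ (dot (c f) (upd t)) (qrf-path-effect f qrf π)) ranked))

OrthogonalToNeutral : ∀ {m d} → List (Trans m d) → (Fin d → ℤ) → Set
OrthogonalToNeutral {m} {d} Ts e = ∀ (f : LinMap m d) → (∀ {t} → t ∈ Ts → Neutral f t) → dot (c f) e ≡ 0ℚ

orthogonal-⊆ : ∀ {m d} {Ts Ts′ : List (Trans m d)} {e} → Ts ⊆ Ts′ → OrthogonalToNeutral Ts e → OrthogonalToNeutral Ts′ e
orthogonal-⊆ Ts⊆Ts′ e⊥ f neutral = e⊥ f (λ t∈Ts → neutral (Ts⊆Ts′ t∈Ts))

cycle-orthogonal : ∀ {m d} {Ts : List (Trans m d)} {x} (π : Path Ts x x) → OrthogonalToNeutral Ts (effect π)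
cycle-orthogonal {x = x} π f neutral = identityˡ-unique _ (w f x) (neutral-path-effect f neutral π)

-- one row (c f , e) per round of Decompose, e the effect of a cycle through an f-ranked transition
Chain : ∀ {m d} → List (Trans m d) → ℕ → Set
Chain {m} {d} Ts k = Σ (List ((Fin d → ℚ) × (Fin d → ℤ))) λ rows →
  length rows ≡ k × Triangular rows × All (λ row → OrthogonalToNeutral Ts (proj₂ row)) rows

chain-⊆ : ∀ {m d} {Ts Ts′ : List (Trans m d)} {k} → Ts ⊆ Ts′ → Chain Ts k → Chain Ts′ k
chain-⊆ Ts⊆Ts′ (rows , |rows|≡k , triangular , rows⊥) = rows , |rows|≡k , triangular , All.map (orthogonal-⊆ Ts⊆Ts′) rows⊥

some-transition : ∀ {m d} {B : VASS m d} → IsVASS B → Σ (Trans m d) (_∈ trans B)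
some-transition {B = B} vB with states B | IsVASS.nonempty vB | IsVASS.outgoing vB
... | []    | nonempty | _           = ⊥-elim (nonempty refl)
... | _ ∷ _ | _        | departs ∷ _ = let (t , t∈B , _) = find departs in t , t∈B

ranked-row : ∀ {m d} {B : VASS m d} → IsVASS B → StronglyConnected B → (f : LinMap m d) → IsQRF B f →
  ∀ {t} → t ∈ trans B → Ranked f t →
  Σ (Fin d → ℤ) λ e → dot (c f) e ≢ 0ℚ × OrthogonalToNeutral (trans B) e
ranked-row {B = B} vB sc f qrf {t} t∈B ranked =
  effect cycle , ranked-cycle-effect f (proj₂ qrf) t∈B ranked back , cycle-orthogonal cycle
  where
  back : Path (trans B) (tgt t) (src t)
  back = let (src∈B , tgt∈B) = All.lookup (IsVASS.endpoints vB) t∈B in sc _ _ tgt∈B src∈B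
  cycle : Path (trans B) (src t) (src t)
  cycle = cons t∈B back

child-result : ∀ {x j} → x ≤R fin j → Σ ℕ λ j′ → x ≡ fin j′ × j′ ℕ.≤ j
child-result (fin≤fin {a} a≤j) = a , refl , a≤j

decompose⇒chain : ∀ {m d} {B : VASS m d} {r k} → IsVASS B → StronglyConnected B →
  Decompose B r → r ≡ fin k → Chain (trans B) k
decompose⇒chain vB sc (dec-∞ _ _ _) ()
decompose⇒chain vB sc (dec-1 f max none-neutral) refl
  with some-transition vB
... | (t , t∈B) with All.lookup (proj₂ (proj₁ max)) t∈B
...   | inj₂ neutral = ⊥-elim (All.lookup none-neutral t∈B neutral)
...   | inj₁ ranked  = let (e , e≢0 , e⊥) = ranked-row vB sc f (proj₁ max) t∈B ranked
                       in ((c f , e) ∷ []) , refl , cons e≢0 [] [] , (e⊥ ∷ [])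
decompose⇒chain vB sc (dec-rec f max _ _ _ _ ∞ _ _) ()
decompose⇒chain {m} {d} {B} vB sc (dec-rec f max _ not-all res decompose (fin j) _ witness) refl
  with find (¬All⇒Any¬ (neutral? f) (trans B) not-all)
... | (t , t∈B , non-neutral) with All.lookup (proj₂ (proj₁ max)) t∈B
...   | inj₂ neutral = ⊥-elim (non-neutral neutral)
...   | inj₁ ranked  =
  let (e , e≢0 , e⊥) = ranked-row vB sc f (proj₁ max) t∈B ranked
      (rows , |rows|≡j , triangular , rows⊥G) = rest witness
  in ((c f , e) ∷ rows) , cong suc |rows|≡j ,
     cons e≢0 (All.map (λ e′⊥ → e′⊥ f G-neutral) rows⊥G) triangular ,
     (e⊥ ∷ All.map (orthogonal-⊆ G⊆B) rows⊥G)
  where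
  G : List (Trans m d)
  G = neutralTrans B f
  G⊆B : G ⊆ trans B
  G⊆B t∈G = proj₁ (∈-filter⁻ (neutral? f) {xs = trans B} t∈G)
  G-neutral : ∀ {t} → t ∈ G → Neutral f t
  G-neutral t∈G = proj₂ (∈-filter⁻ (neutral? f) {xs = trans B} t∈G)
  rest : (Σ (VASS m d) λ B′ → Σ (IsSCC (states B) G B′) λ scc → res B′ scc ≡ fin j)
       ⊎ ((fin j ≡ fin 0) × (∀ B′ → ¬ IsSCC (states B) G B′)) → Chain G j
  rest (inj₁ (B′ , scc , res≡j)) = chain-⊆ (SubVASS.transSub (IsSCC.sub scc))
    (decompose⇒chain (IsSCC.isVASS scc) (IsSCC.sc scc) (decompose B′ scc) res≡j)
  rest (inj₂ (refl , _)) = [] , refl , [] , []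

uniform-bound : ∀ {n} {Cyclic : Fin n → Set} (P : Fin n → ℕ → Set) → (∀ q {a a′} → a ℕ.≤ a′ → P q a → P q a′) →
  (∀ q → Dec (Cyclic q)) → (∀ q → Cyclic q → Σ ℕ (P q)) → Σ ℕ λ a → ∀ q → Cyclic q → P q a
uniform-bound {n} {Cyclic} P P-mono cyclic? bound = a , λ q cq →
  P-mono q (proj₂ (bounded-above (λ q → chosen q (cyclic? q)) (allFin n)) (∈-allFin q)) (chosen-sound q (cyclic? q) cq)
  where
  chosen : ∀ q → Dec (Cyclic q) → ℕ
  chosen q (yes cq) = proj₁ (bound q cq)
  chosen q (no _)   = 0
  chosen-sound : ∀ q (cq? : Dec (Cyclic q)) → Cyclic q → P q (chosen q cq?)
  chosen-sound q (yes cq) _   = proj₂ (bound q cq)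
  chosen-sound q (no ¬cq) cq = ⊥-elim (¬cq cq)
  a : ℕ
  a = proj₁ (bounded-above (λ q → chosen q (cyclic? q)) (allFin n))

no-neutral-path : ∀ {m d} {B : VASS m d} {f : LinMap m d} → All (λ t → ¬ Neutral f t) (trans B) →
  ∀ {x y} → ¬ Path (neutralTrans B f) x y
no-neutral-path {B = B} {f} none π =
  let (t , t∈G , _) = find (departs π) ; (t∈B , neutral) = ∈-filter⁻ (neutral? f) {xs = trans B} t∈G
  in All.lookup none t∈B neutral

lengthBoundAt-mono : ∀ {m d} {A : VASS m d} {g s n n′} → n ℕ.≤ n′ → LengthBoundAt A g s n → LengthBoundAt A g s n′
lengthBoundAt-mono n≤n′ bound π W = ℕP.≤-trans (bound π W) n≤n′

decompose⇒lengthBound : ∀ {m d} {B : VASS m d} {r k} → IsVASS B → Decompose B r → r ≡ fin k →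
  ∀ g → Σ (ℕ → ℕ) (LengthBound B g)
decompose⇒lengthBound vB (dec-∞ _ _ _) () g
decompose⇒lengthBound {B = B} vB (dec-1 f max none-neutral) refl g =
  _ , DecomposeRound.length-bound B vB f (proj₁ max) g (λ _ → 0) (λ q cycle → ⊥-elim (no-neutral-path {B = B} none-neutral cycle))
decompose⇒lengthBound vB (dec-rec _ _ _ _ _ _ ∞ _ _) () g
decompose⇒lengthBound {B = B} vB (dec-rec f max _ _ res decompose (fin j) res≤j _) refl g =
  _ , length-bound g (λ s → proj₁ (uniform s)) (λ q cycle s → proj₂ (uniform s) q cycle)
  where
  open DecomposeRound B vB f (proj₁ max)
  open PathSearch G using (path?)
  child : ∀ q → Path G q q → Σ (ℕ → ℕ) (LengthBound (component q) g)
  child q cycle = let scc = component-isSCC q cycle in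
    decompose⇒lengthBound (IsSCC.isVASS scc) (decompose _ scc) (proj₁ (proj₂ (child-result (res≤j _ scc)))) g
  uniform : ∀ s → Σ ℕ λ n → ∀ q → Path G q q → LengthBoundAt (component q) g s n
  uniform s = uniform-bound (λ q → LengthBoundAt (component q) g s) (λ q → lengthBoundAt-mono) (λ q → path? q q)
                            (λ q cycle → proj₁ (child q cycle) s , proj₂ (child q cycle) s)

polynomial-budget : ∀ m α β a k s →
  (suc (α ℕ.* s ℕ.+ β) ℕ.* suc m ℕ.+ m) ℕ.* suc (a ℕ.* suc s ^ k)
    ℕ.≤ (suc (α ℕ.+ β) ℕ.* suc m ℕ.+ m) ℕ.* suc a ℕ.* suc s ^ suc k
polynomial-budget m α β a k s = begin
  (suc (α ℕ.* s ℕ.+ β) ℕ.* suc m ℕ.+ m) ℕ.* suc (a ℕ.* P)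
    ≤⟨ ℕP.*-mono-≤ level≤ (ℕP.+-monoˡ-≤ (a ℕ.* P) (ℕP.m^n>0 (suc s) k)) ⟩
  (C ℕ.* suc s) ℕ.* (P ℕ.+ a ℕ.* P)
    ≡⟨ solve 4 (λ C s a P → (C :* s) :* (P :+ a :* P) := C :* (con 1 :+ a) :* (s :* P)) refl C (suc s) a P ⟩
  C ℕ.* suc a ℕ.* suc s ^ suc k ∎
  where
  open ℕP.≤-Reasoning
  open ℕ-Solver
  P C : ℕ
  P = suc s ^ k
  C = suc (α ℕ.+ β) ℕ.* suc m ℕ.+ m
  level≤ : suc (α ℕ.* s ℕ.+ β) ℕ.* suc m ℕ.+ m ℕ.≤ C ℕ.* suc s
  level≤ = ℕP.≤-trans (ℕP.m≤m+n _ ((α ℕ.+ β ℕ.* s ℕ.+ s) ℕ.* suc m ℕ.+ m ℕ.* s))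
    (ℕP.≤-reflexive (solve 4 (λ α β s m → (con 1 :+ (α :* s :+ β)) :* (con 1 :+ m) :+ m
                                            :+ ((α :+ β :* s :+ s) :* (con 1 :+ m) :+ m :* s)
                                         := ((con 1 :+ (α :+ β)) :* (con 1 :+ m) :+ m) :* (con 1 :+ s)) refl α β s m))

module _ {m d : ℕ} (B : VASS m d) (vB : IsVASS B) (f : LinMap m d) (qrf : IsQRF B f) where
  open DecomposeRound B vB f qrf

  round-polynomial : ∀ a k → (∀ q → Path G q q → LengthBound (component q) 0 (λ s → a ℕ.* suc s ^ k)) →
    Σ ℕ λ A → LengthBound B 0 (λ s → A ℕ.* suc s ^ suc k)
  round-polynomial a k component-bound = (suc (α ℕ.+ β) ℕ.* suc m ℕ.+ m) ℕ.* suc a , λ s π W → begin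
    _                                                                 ≤⟨ length-bound 0 b component-bound s π W ⟩
    budget m 0 b (initialLevel s) m s                                 ≤⟨ budget-static m b (initialLevel s) m s ⟩
    (initialLevel s ℕ.* suc m ℕ.+ m) ℕ.* suc (b s)                    ≤⟨ polynomial-budget m α β a k s ⟩
    (suc (α ℕ.+ β) ℕ.* suc m ℕ.+ m) ℕ.* suc a ℕ.* suc s ^ suc k      ∎
    where
    open ℕP.≤-Reasoning
    b : ℕ → ℕ
    b s = a ℕ.* suc s ^ k

decompose⇒polynomialBound : ∀ {m d} {B : VASS m d} {r k} → IsVASS B → Decompose B r → r ≡ fin k →
  Σ ℕ λ a → LengthBound B 0 (λ s → a ℕ.* suc s ^ k)
decompose⇒polynomialBound vB (dec-∞ _ _ _) ()
decompose⇒polynomialBound {B = B} vB (dec-1 f max none-neutral) refl =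
  round-polynomial B vB f (proj₁ max) 0 0 (λ q cycle → ⊥-elim (no-neutral-path {B = B} none-neutral cycle))
decompose⇒polynomialBound vB (dec-rec _ _ _ _ _ _ ∞ _ _) ()
decompose⇒polynomialBound {B = B} vB (dec-rec f max _ _ res decompose (fin j) res≤j _) refl =
  round-polynomial B vB f (proj₁ max) (proj₁ uniform) j (proj₂ uniform)
  where
  open DecomposeRound B vB f (proj₁ max)
  open PathSearch G using (path?)
  child : ∀ q → Path G q q → Σ ℕ λ a → LengthBound (component q) 0 (λ s → a ℕ.* suc s ^ j)
  child q cycle =
    let scc = component-isSCC q cycle
        (j′ , res≡j′ , j′≤j) = child-result (res≤j _ scc)
        (a , bound) = decompose⇒polynomialBound (IsSCC.isVASS scc) (decompose _ scc) res≡j′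
    in a , λ s π W → ℕP.≤-trans (bound s π W) (ℕP.*-monoʳ-≤ a (ℕP.^-monoʳ-≤ (suc s) j′≤j))
  uniform : Σ ℕ λ a → ∀ q → Path G q q → LengthBound (component q) 0 (λ s → a ℕ.* suc s ^ j)
  uniform = uniform-bound (λ q a → LengthBound (component q) 0 (λ s → a ℕ.* suc s ^ j))
                          (λ q a≤a′ bound s π W → ℕP.≤-trans (bound s π W) (ℕP.*-monoˡ-≤ _ a≤a′))
                          (λ q → path? q q) child

module _ {m d : ℕ} (A : VASS m d) (g : LinMap m d) (positive : IsPositiveQRF A g) where

  open Potential g (proj₁ (proj₁ positive))

  private
    c≥0 : ∀ i → 0ℚ ℚ.≤ c g i
    c≥0 = proj₁ (proj₁ positive)
    instance c≢0 : ∀ {i} → ℚ.NonZero (c g i)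
    c≢0 {i} = ℚ.>-nonZero (proj₂ positive i)

    M : Fin d → ℕ
    M i = proj₁ (archimedean (ℚ.1/ c g i))

  Mₘₐₓ : ℕ
  Mₘₐₓ = proj₁ (bounded-above M (allFin d))

  coordinate-bound : ∀ {p v Z} → potential p v ℚ.< level Z → ∀ i → v i ℕ.≤ Mₘₐₓ ℕ.* Z
  coordinate-bound {p} {v} {Z} pot<level i = ℕP.≤-trans (fromℕ-cancel-≤ (begin
      fromℕ (v i)                        ≡⟨ sym (ℚP.*-identityˡ _) ⟩
      1ℚ * fromℕ (v i)                   ≤⟨ ℚP.*-monoʳ-≤-nonNeg (fromℕ (v i)) {{ℚ.nonNegative (fromℕ-nonNeg (v i))}} 1≤M*c ⟩
      fromℕ (M i) * c g i * fromℕ (v i)  ≡⟨ ℚP.*-assoc (fromℕ (M i)) (c g i) (fromℕ (v i)) ⟩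
      fromℕ (M i) * (c g i * fromℕ (v i)) ≤⟨ ℚP.*-monoˡ-≤-nonNeg (fromℕ (M i)) {{ℚ.nonNegative (fromℕ-nonNeg (M i))}}
                                               (ℚP.≤-trans (coeff*coord≤dot (c g) v c≥0 i) (ℚP.<⇒≤ dot<Z)) ⟩
      fromℕ (M i) * fromℕ Z              ≡⟨ sym (fromℕ-homo-* (M i) Z) ⟩
      fromℕ (M i ℕ.* Z)                  ∎))
    (ℕP.*-monoˡ-≤ Z (proj₂ (bounded-above M (allFin d)) (∈-allFin i)))
    where
    open ℚP.≤-Reasoning
    open ℚ-Solver
    1≤M*c : 1ℚ ℚ.≤ fromℕ (M i) * c g i
    1≤M*c = subst (ℚ._≤ fromℕ (M i) * c g i) (ℚP.*-inverseˡ (c g i))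
      (ℚP.*-monoʳ-≤-nonNeg (c g i) {{ℚ.nonNegative (c≥0 i)}} (proj₂ (archimedean (ℚ.1/ c g i))))
    dot<Z : dot (c g) (toℤᵛ v) ℚ.< fromℕ Z
    dot<Z = subst₂ ℚ._<_ (solve 2 (λ a b → a :+ b :- b := a) refl (dot (c g) (toℤᵛ v)) wₗ)
                         (solve 2 (λ b z → b :+ z :- b := z) refl wₗ (fromℕ Z))
      (ℚP.+-monoˡ-< (ℚ.- wₗ) (ℚP.≤-<-trans (ℚP.+-monoʳ-≤ (dot (c g) (toℤᵛ v)) (wₗ≤w p)) pot<level))

  within-static : ∀ {p v n Z} → potential p v ℚ.< level Z → (π : Comp A p v n) → Within 0 (Mₘₐₓ ℕ.* Z) π
  within-static pot<level stop = size-lub _ (coordinate-bound pot<level)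
  within-static pot<level (step t t∈A _ w≡v+u π) = size-lub _ (coordinate-bound pot<level) ,
    within-static (ℚP.≤-<-trans (potential-nonincreasing w≡v+u (All.lookup (proj₂ (proj₁ positive)) t∈A)) pot<level) π

^-distribʳ-* : ∀ a b k → (a ℕ.* b) ^ k ≡ a ^ k ℕ.* b ^ k
^-distribʳ-* a b zero    = refl
^-distribʳ-* a b (suc k) = ≡.trans (cong (a ℕ.* b ℕ.*_) (^-distribʳ-* a b k))
  (solve 4 (λ a b x y → a :* b :* (x :* y) := a :* x :* (b :* y)) refl a b (a ^ k) (b ^ k))
  where open ℕ-Solver

decompose⇒1≤k : ∀ {m d} {A : VASS m d} {r k} → Decompose A r → r ≡ fin k → 1 ℕ.≤ k
decompose⇒1≤k (dec-∞ _ _ _)                       ()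
decompose⇒1≤k (dec-1 _ _ _)                       refl = s≤s z≤n
decompose⇒1≤k (dec-rec _ _ _ _ _ _ (fin _) _ _)  refl = s≤s z≤n
decompose⇒1≤k (dec-rec _ _ _ _ _ _ ∞ _ _)        ()

module _ {m d : ℕ} {A : VASS m d} {k : ℕ} (vA : IsVASS A) (D : Decompose A (fin k)) where

  decompose⇒terminating : Terminating A
  decompose⇒terminating n =
    let (b , bound) = decompose⇒lengthBound vA D refl (updateBound A)
    in b n , λ _ _ _ _ size≡n π → bound n π (within-updateBound (ℕP.≤-reflexive size≡n) π)

  decompose⇒polynomial : Σ (LinMap m d) (IsPositiveQRF A) → LinO A k
  decompose⇒polynomial (g , positive) = suc (a ℕ.* C ^ k) , s≤s z≤n , 1 , bound
    where
    open Potential g (proj₁ (proj₁ positive))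
    a M C : ℕ
    a = proj₁ (decompose⇒polynomialBound vA D refl)
    M = Mₘₐₓ A g positive
    C = M ℕ.* suc (α ℕ.+ β) ℕ.+ 1
    bound : ∀ n → 1 ℕ.≤ n → LBoundedBy A n (suc (a ℕ.* C ^ k) ℕ.* n ^ k)
    bound (suc n) _ p v len _ size≡n π = begin
      len
        ≤⟨ proj₂ (decompose⇒polynomialBound vA D refl) (M ℕ.* initialLevel (suc n)) π
             (within-static A g positive (potential<initialLevel p (ℕP.≤-reflexive size≡n)) π) ⟩
      a ℕ.* suc (M ℕ.* initialLevel (suc n)) ^ k
        ≤⟨ ℕP.*-monoʳ-≤ a (ℕP.^-monoˡ-≤ k size≤C*n) ⟩
      a ℕ.* (C ℕ.* suc n) ^ k
        ≡⟨ ≡.trans (cong (a ℕ.*_) (^-distribʳ-* C (suc n) k)) (sym (ℕP.*-assoc a (C ^ k) _)) ⟩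
      a ℕ.* C ^ k ℕ.* suc n ^ k
        ≤⟨ ℕP.m≤n+m _ _ ⟩
      suc (a ℕ.* C ^ k) ℕ.* suc n ^ k ∎
      where
      open ℕP.≤-Reasoning
      open ℕ-Solver
      size≤C*n : suc (M ℕ.* initialLevel (suc n)) ℕ.≤ C ℕ.* suc n
      size≤C*n = ℕP.≤-trans (ℕP.m≤m+n _ (M ℕ.* n ℕ.+ M ℕ.* β ℕ.* n ℕ.+ n)) (ℕP.≤-reflexive
        (solve 4 (λ M α β n → con 1 :+ M :* (con 1 :+ (α :* (con 1 :+ n) :+ β)) :+ (M :* n :+ M :* β :* n :+ n)
                             := (M :* (con 1 :+ (α :+ β)) :+ con 1) :* (con 1 :+ n)) refl M α β n))

-- The hypothesis trans A ≢ [] is implied by IsVASS A: every state has an outgoing transition.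
mainTheorem5 : (m d : ℕ) (A : VASS m d) → IsVASS A → StronglyConnected A → trans A ≢ [] →
    (k : ℕ) (tight : Bool) → Alg1Returns A k tight →
    ((1 ℕ.≤ k) × (k ℕ.≤ d)) × Terminating A × (tight ≡ true → LinO A k)
mainTheorem5 m d A vA sc _ k tight result =
  (decompose⇒1≤k D refl , k≤d) ,
  decompose⇒terminating vA D ,
  λ tight≡true → decompose⇒polynomial vA D (proj₁ (Alg1Returns.tightSpec result) tight≡true)
  where
  D : Decompose A (fin k)
  D = Alg1Returns.decomp result
  k≤d : k ℕ.≤ d
  k≤d = let (rows , |rows|≡k , triangular , _) = decompose⇒chain vA sc D refl
        in subst (ℕ._≤ d) |rows|≡k (triangular-length≤dim rows triangular)
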